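{- Let $H$ be a hypergraph, $u \in V(H)$, and $F \subseteq E(H)$ such that each edge in $F$ contains $u$. Construct a hypergraph $H'$ from $H$ by adjoining, for each $f \in F$, a new vertex $u_f$, and replacing each edge $f \in F$ with the two edges $f'=(f-\{u \}) \cup \{ u_f \}$ and $e_f=\{ u_f,u \}$. Then $H$ has an Euler family traversing vertex $u$ via each edge in $F$ if and only if $H'$ has an Euler family; and $H$ has an Euler tour traversing vertex $u$ via each edge in $F$ if and only if $H'$ has an Euler tour.
   Context: A hypergraph $H=(V,E)$: non-empty finite vertex set $V$ and finite multiset $E$ of subsets of $V$ (edges). Distinct $u,v$ are adjacent via $e$ if $u,v\in e$. A walk is $v_0e_1v_1\ldots e_kv_k$ with $v_{i-1},v_i$ adjacent via $e_i$; anchors are $v_0,\dots,v_k$; closed if $v_0=v_k$, $k\ge2$; trail if edges are pairwise distinct. A walk traverses vertex $v$ via edge $e$ if $ev$ or $ve$ is a consecutive subsequence of it; a family of walks does so if one of its walks does. An Euler tour is a closed trail traversing every edge; an Euler family is a set of pairwise edge-disjoint and anchor-disjoint closed trails jointly traversing every edge. -}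

module Defs where

open import Data.Nat using (ℕ; suc; _≤_)
open import Data.Fin using (Fin)
open import Data.Bool using (Bool; true)
open import Data.Unit using (⊤)
open import Data.Empty using (⊥)
open import Data.Product using (Σ; ∃; _×_; _,_; proj₁; proj₂)
open import Data.Sum using (_⊎_; inj₁; inj₂)
open import Data.List using (List; []; _∷_; map; length)
open import Data.List.Membership.Propositional using (_∈_; _∉_)
open import Data.List.Relation.Unary.All using (All)
open import Data.List.Relation.Unary.Unique.Propositional using (Unique)
open import Data.List.Relation.Unary.AllPairs using (AllPairs)
open import Relation.Nullary using (¬_)
open import Relation.Binary.PropositionalEquality using (_≡_; _≢_)
open import Function.Bundles using (_↔_)

-- A hypergraph: a vertex type, an edge-index type (edges are indexed, so
-- the edge collection is a multiset), and the incidence relation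
-- (edge e, as a subset of the vertices, contains v).
record Hypergraph : Set₁ where
  field
    Vtx : Set
    Edg : Set
    inc : Edg → Vtx → Set
open Hypergraph public

IsFinite : Hypergraph → Set
IsFinite H = (Σ ℕ λ k → Vtx H ↔ Fin (suc k)) × (Σ ℕ λ m → Edg H ↔ Fin m)

module _ (H : Hypergraph) where

  Adj : Edg H → Vtx H → Vtx H → Set
  Adj e x y = x ≢ y × inc H e x × inc H e y

  -- A walk v0 e1 v1 ... ek vk is given by v0 and the list [(e1,v1),...,(ek,vk)].
  record Walk : Set where
    constructor walk
    field
      start : Vtx H
      steps : List (Edg H × Vtx H)

  IsWalkFrom : Vtx H → List (Edg H × Vtx H) → Set
  IsWalkFrom v [] = ⊤
  IsWalkFrom v ((e , w) ∷ s) = Adj e v w × IsWalkFrom w s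

  lastAnchor : Vtx H → List (Edg H × Vtx H) → Vtx H
  lastAnchor v [] = v
  lastAnchor v ((e , w) ∷ s) = lastAnchor w s

  anchors : Walk → List (Vtx H)
  anchors (walk v s) = v ∷ map proj₂ s

  edges : Walk → List (Edg H)
  edges (walk v s) = map proj₁ s

  IsWalk : Walk → Set
  IsWalk (walk v s) = IsWalkFrom v s

  IsClosed : Walk → Set
  IsClosed (walk v s) = (lastAnchor v s ≡ v) × (2 ≤ length s)

  IsTrail : Walk → Set
  IsTrail W = Unique (edges W)

  IsClosedTrail : Walk → Set
  IsClosedTrail W = IsWalk W × IsClosed W × IsTrail W

  -- "e v" or "v e" is a consecutive subsequence
  TravFrom : Vtx H → Edg H → Vtx H → List (Edg H × Vtx H) → Set
  TravFrom v e x [] = ⊥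
  TravFrom v e x ((e' , w) ∷ s) = (e' ≡ e × (x ≡ v ⊎ w ≡ v)) ⊎ TravFrom v e w s

  Traverses : Walk → Vtx H → Edg H → Set
  Traverses (walk x s) v e = TravFrom v e x s

  Disjoint : {A : Set} → List A → List A → Set
  Disjoint xs ys = ∀ {a} → a ∈ xs → a ∉ ys

  EdgeAnchorDisjoint : Walk → Walk → Set
  EdgeAnchorDisjoint W W' = Disjoint (edges W) (edges W') × Disjoint (anchors W) (anchors W')

  IsEulerTour : Walk → Set
  IsEulerTour W = IsClosedTrail W × (∀ e → e ∈ edges W)

  -- a family (list; pairwise edge-disjoint closed trails of length ≥ 2 are distinct)
  IsEulerFamily : List Walk → Set
  IsEulerFamily Ws = All IsClosedTrail Ws × AllPairs EdgeAnchorDisjoint Ws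
                   × (∀ e → ∃ λ W → W ∈ Ws × e ∈ edges W)

  HasEulerTour : Set
  HasEulerTour = ∃ IsEulerTour

  HasEulerFamily : Set
  HasEulerFamily = ∃ IsEulerFamily

  -- with F ⊆ E given as a Boolean predicate on edges
  HasEulerTourVia : Vtx H → (Edg H → Bool) → Set
  HasEulerTourVia u F = ∃ λ W → IsEulerTour W × (∀ f → F f ≡ true → Traverses W u f)

  HasEulerFamilyVia : Vtx H → (Edg H → Bool) → Set
  HasEulerFamilyVia u F = ∃ λ Ws → IsEulerFamily Ws
    × (∀ f → F f ≡ true → ∃ λ W → W ∈ Ws × Traverses W u f)

-- The construction of H'.
-- Vertices: old vertices, plus u_f for each f ∈ F.
-- Edges: inj₁ e is e itself if e ∉ F and f' = (f - {u}) ∪ {u_f} if e = f ∈ F;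
--        inj₂ f is e_f = {u_f, u}.
module _ (H : Hypergraph) (u : Vtx H) (F : Edg H → Bool) where
  FE : Set
  FE = Σ (Edg H) λ f → F f ≡ true

  splitInc : Edg H ⊎ FE → Vtx H ⊎ FE → Set
  splitInc (inj₁ e) (inj₁ v) = inc H e v × (F e ≡ true → v ≢ u)
  splitInc (inj₁ e) (inj₂ (f , _)) = e ≡ f
  splitInc (inj₂ (f , _)) (inj₁ v) = v ≡ u
  splitInc (inj₂ (f , _)) (inj₂ (g , _)) = f ≡ g

  split : Hypergraph
  split = record { Vtx = Vtx H ⊎ FE ; Edg = Edg H ⊎ FE ; inc = splitInc }

{-# OPTIONS --safe #-}
-- A closed trail of H that traverses u via each f ∈ F it uses passes through u in the step
-- using f, and that step x f w lifts to two steps through the new vertex u_f (u e_f u_f f′ w,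
-- or x f′ u_f e_f u). Conversely u_f lies only on f′ and e_f, so a trail of H′ can only pass
-- through u_f by using f′ and e_f consecutively, and that pair contracts to a step of H
-- traversing u via f; a trail of H′ starting at some u_f is first rotated to start at an old
-- vertex. Both translations preserve closed trails and edge- and anchor-disjointness and match
-- coverage of f′ and e_f with coverage of f and traversal of u via f.
module Submission where

open import Defs
open import Axiom.UniquenessOfIdentityProofs using (module Decidable⇒UIP)
open import Data.Bool using (Bool; true; false)
open import Data.Bool.Properties using (_≟_)
open import Data.Empty using (⊥-elim)
open import Data.List using (List; []; _∷_; _∷ʳ_; map; length)
open import Data.List.Membership.Propositional using (_∈_; _∉_)
open import Data.List.Relation.Binary.Permutation.Propositional using (↭-sym; ↭⇒↭ₛ)
open import Data.List.Relation.Binary.Permutation.Propositional.Properties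
  using (∈-resp-↭; map⁺; ∷↭∷ʳ; ↭-length)
import Data.List.Relation.Binary.Permutation.Setoid.Properties as PermutationProperties
open import Data.List.Relation.Binary.Pointwise using (Pointwise; []; _∷_)
open import Data.List.Relation.Binary.Subset.Propositional using (_⊆_)
open import Data.List.Relation.Unary.All as All using (All; []; _∷_)
open import Data.List.Relation.Unary.All.Properties using (All¬⇒¬Any; ¬Any⇒All¬)
open import Data.List.Relation.Unary.AllPairs using (AllPairs; []; _∷_)
open import Data.List.Relation.Unary.Any using (here; there)
open import Data.List.Relation.Unary.Unique.Propositional using (Unique)
open import Data.Nat using (_≤_; _<_; z≤n; s≤s)
open import Data.Nat.Properties using (≤-trans; m≤n⇒m≤1+n)
open import Data.Product using (_×_; ∃; ∃₂; _,_; proj₁; proj₂)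
open import Data.Sum using (_⊎_; inj₁; inj₂)
open import Data.Sum.Properties using (inj₁-injective)
open import Data.Unit using (tt)
open import Function using (flip)
open import Function.Bundles using (_⇔_; mk⇔)
open import Relation.Binary.PropositionalEquality
  using (_≡_; _≢_; refl; sym; trans; cong; subst; setoid)
open import Relation.Nullary using (¬_; contradiction)

AllPairs-∈ : ∀ {A : Set} {R : A → A → Set} {xs x y} →
  AllPairs R xs → x ∈ xs → y ∈ xs → x ≡ y ⊎ R x y ⊎ R y x
AllPairs-∈ (_ ∷ _) (here refl) (here refl) = inj₁ refl
AllPairs-∈ (rs ∷ _) (here refl) (there y∈) = inj₂ (inj₁ (All.lookup rs y∈))
AllPairs-∈ (rs ∷ _) (there x∈) (here refl) = inj₂ (inj₂ (All.lookup rs x∈))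
AllPairs-∈ (_ ∷ rss) (there x∈) (there y∈) = AllPairs-∈ rss x∈ y∈

module _ {A B : Set} {R : A → B → Set} where

  All∃⇒Pointwise : ∀ {xs} → All (λ x → ∃ (R x)) xs → ∃ (Pointwise R xs)
  All∃⇒Pointwise [] = [] , []
  All∃⇒Pointwise ((y , r) ∷ rs) with ys , rs′ ← All∃⇒Pointwise rs = y ∷ ys , r ∷ rs′

  Pointwise-∈ˡ : ∀ {xs ys x} → Pointwise R xs ys → x ∈ xs → ∃ λ y → y ∈ ys × R x y
  Pointwise-∈ˡ (r ∷ _) (here refl) = _ , here refl , r
  Pointwise-∈ˡ (_ ∷ rs) (there x∈) with y , y∈ , r ← Pointwise-∈ˡ rs x∈ = y , there y∈ , r

  Pointwise-All : ∀ {P : A → Set} {Q : B → Set} {xs ys} →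
    (∀ {x y} → R x y → P x → Q y) → Pointwise R xs ys → All P xs → All Q ys
  Pointwise-All f [] [] = []
  Pointwise-All f (r ∷ rs) (p ∷ ps) = f r p ∷ Pointwise-All f rs ps

  Pointwise-AllPairs : ∀ {S : A → A → Set} {T : B → B → Set} {xs ys} →
    (∀ {x x′ y y′} → R x y → R x′ y′ → S x x′ → T y y′) →
    Pointwise R xs ys → AllPairs S xs → AllPairs T ys
  Pointwise-AllPairs f [] [] = []
  Pointwise-AllPairs f (r ∷ rs) (ss ∷ sss) =
    Pointwise-All (f r) rs ss ∷ Pointwise-AllPairs f rs sss

module Walks (G : Hypergraph) where

  Steps : Set
  Steps = List (Edg G × Vtx G)

  travFrom⇒∈ : ∀ {v e} x (s : Steps) → TravFrom G v e x s → e ∈ map proj₁ s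
  travFrom⇒∈ x [] ()
  travFrom⇒∈ x ((_ , w) ∷ s) (inj₁ (refl , _)) = here refl
  travFrom⇒∈ x ((_ , w) ∷ s) (inj₂ t) = there (travFrom⇒∈ w s t)

  traverses⇒∈edges : ∀ W {v e} → Traverses G W v e → e ∈ edges G W
  traverses⇒∈edges (walk x s) = travFrom⇒∈ x s

  lastAnchor∈anchors : ∀ x (s : Steps) → lastAnchor G x s ∈ anchors G (walk x s)
  lastAnchor∈anchors x [] = here refl
  lastAnchor∈anchors x ((_ , w) ∷ s) = there (lastAnchor∈anchors w s)

  closedWalk-length : ∀ x (s : Steps) → IsWalkFrom G x s → lastAnchor G x s ≡ x →
    0 < length s → 2 ≤ length s
  closedWalk-length x ((_ , w) ∷ []) ((x≢w , _) , _) w≡x _ = contradiction (sym w≡x) x≢w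
  closedWalk-length x (_ ∷ _ ∷ _) _ _ _ = s≤s (s≤s z≤n)

  isWalkFrom-∷ʳ : ∀ x (s : Steps) {e y} →
    IsWalkFrom G x s → Adj G e (lastAnchor G x s) y → IsWalkFrom G x (s ∷ʳ (e , y))
  isWalkFrom-∷ʳ x [] _ a = a , tt
  isWalkFrom-∷ʳ x ((_ , w) ∷ s) (a , p) a′ = a , isWalkFrom-∷ʳ w s p a′

  lastAnchor-∷ʳ : ∀ x (s : Steps) {e y} → lastAnchor G x (s ∷ʳ (e , y)) ≡ y
  lastAnchor-∷ʳ x [] = refl
  lastAnchor-∷ʳ x ((_ , w) ∷ s) = lastAnchor-∷ʳ w s

  open PermutationProperties (setoid (Edg G)) using (Unique-resp-↭)

  rotate-isClosedTrail : ∀ {v e w} (s : Steps) →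
    IsClosedTrail G (walk v ((e , w) ∷ s)) → IsClosedTrail G (walk w (s ∷ʳ (e , w)))
  rotate-isClosedTrail {v} {e} {w} s ((a , p) , (closed , len) , unique) =
    isWalkFrom-∷ʳ w s p (subst (λ z → Adj G e z w) (sym closed) a)
    , (lastAnchor-∷ʳ w s , subst (2 ≤_) (↭-length (∷↭∷ʳ (e , w) s)) len)
    , Unique-resp-↭ (↭⇒↭ₛ (map⁺ proj₁ (∷↭∷ʳ (e , w) s))) unique

  record SameSupport (W₁ W₂ : Walk G) : Set where
    field
      edges⊆ : edges G W₁ ⊆ edges G W₂
      edges⊇ : edges G W₂ ⊆ edges G W₁
      anchors⊆ : anchors G W₁ ⊆ anchors G W₂
      anchors⊇ : anchors G W₂ ⊆ anchors G W₁

  rotate-sameSupport : ∀ {v e w} (s : Steps) → lastAnchor G w s ≡ v →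
    SameSupport (walk w (s ∷ʳ (e , w))) (walk v ((e , w) ∷ s))
  rotate-sameSupport {v} {e} {w} s closed = record
    { edges⊆ = ∈-resp-↭ (↭-sym (map⁺ proj₁ ρ))
    ; edges⊇ = ∈-resp-↭ (map⁺ proj₁ ρ)
    ; anchors⊆ = anchors⊆
    ; anchors⊇ = anchors⊇
    }
    where
    ρ = ∷↭∷ʳ (e , w) s
    σ = map⁺ proj₂ ρ
    anchors⊆ : anchors G (walk w (s ∷ʳ (e , w))) ⊆ anchors G (walk v ((e , w) ∷ s))
    anchors⊆ (here refl) = there (here refl)
    anchors⊆ (there a∈) = there (∈-resp-↭ (↭-sym σ) a∈)
    anchors⊇ : anchors G (walk v ((e , w) ∷ s)) ⊆ anchors G (walk w (s ∷ʳ (e , w)))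
    anchors⊇ (here refl) = there (∈-resp-↭ σ (subst (_∈ _) closed (lastAnchor∈anchors w s)))
    anchors⊇ (there a∈) = there (∈-resp-↭ σ a∈)

module Transfer {G G′ : Hypergraph} (R : Walk G → Walk G′ → Set)
  (R⇒trail : ∀ {W W′} → R W W′ → IsClosedTrail G′ W′)
  (R-disjoint : ∀ {W₁ W₁′ W₂ W₂′} → R W₁ W₁′ → R W₂ W₂′ →
    EdgeAnchorDisjoint G W₁ W₂ → EdgeAnchorDisjoint G′ W₁′ W₂′)
  (R-cover : ∀ e′ → ∃ λ e → ∀ {W W′} → R W W′ → e ∈ edges G W → e′ ∈ edges G′ W′)
  where

  eulerTour : ∀ {W W′} → R W W′ → IsEulerTour G W → IsEulerTour G′ W′
  eulerTour r (_ , covered) = R⇒trail r , λ e′ → let e , e⇒e′ = R-cover e′ in e⇒e′ r (covered e)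

  eulerFamily : ∀ {Ws Ws′} → Pointwise R Ws Ws′ → IsEulerFamily G Ws → IsEulerFamily G′ Ws′
  eulerFamily {Ws′ = Ws′} rs (trails , disjoint , covered) =
    Pointwise-All (λ r _ → R⇒trail r) rs trails , Pointwise-AllPairs R-disjoint rs disjoint , covered′
    where
    covered′ : ∀ e′ → ∃ λ W′ → W′ ∈ Ws′ × e′ ∈ edges G′ W′
    covered′ e′ with R-cover e′
    ... | e , e⇒e′ with covered e
    ... | W , W∈ , e∈ with Pointwise-∈ˡ rs W∈
    ... | W′ , W′∈ , r = W′ , W′∈ , e⇒e′ r e∈

module Splitting (H : Hypergraph) (u : Vtx H) (F : Edg H → Bool)
  (F∋u : ∀ f → F f ≡ true → inc H f u) where

  H′ : Hypergraph
  H′ = split H u F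

  open Walks

  FE-≡ : ∀ {f} (p q : F f ≡ true) → _≡_ {A = FE H u F} (f , p) (f , q)
  FE-≡ {f} p q = cong (f ,_) (Decidable⇒UIP.≡-irrelevant _≟_ p q)

  parent : Edg H′ → Edg H
  parent (inj₁ e) = e
  parent (inj₂ (f , _)) = f

  new-nonadjacent : ∀ {e′ g h} → ¬ Adj H′ e′ (inj₂ g) (inj₂ h)
  new-nonadjacent {inj₁ _} {_ , p} {_ , q} (g≢h , refl , refl) = g≢h (cong inj₂ (FE-≡ p q))
  new-nonadjacent {inj₂ _} {_ , p} {_ , q} (g≢h , refl , refl) = g≢h (cong inj₂ (FE-≡ p q))

  -- A step x f w of H with f ∈ F and x = u (resp. w = u) lifts to u e_f u_f f′ w
  -- (resp. x f′ u_f e_f u). A step may also be kept as is, even for f ∈ F when neither end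
  -- is u: a trail of H′ may use f′ without passing through u_f.
  data Lift : Vtx H → Steps H → Set where
    [] : ∀ {x} → Lift x []
    direct : ∀ {x e w s} → (F e ≡ true → x ≢ u) → (F e ≡ true → w ≢ u) →
      Lift w s → Lift x ((e , w) ∷ s)
    fromU : ∀ {x e w s} → F e ≡ true → x ≡ u → Lift w s → Lift x ((e , w) ∷ s)
    toU : ∀ {x e w s} → F e ≡ true → w ≡ u → Lift w s → Lift x ((e , w) ∷ s)

  expand : ∀ {x s} → Lift x s → Steps H′
  expand [] = []
  expand (direct {e = e} {w} _ _ l) = (inj₁ e , inj₁ w) ∷ expand l
  expand (fromU {e = e} {w} p _ l) = (inj₂ (e , p) , inj₂ (e , p)) ∷ (inj₁ e , inj₁ w) ∷ expand l
  expand (toU {e = e} {w} p _ l) = (inj₁ e , inj₂ (e , p)) ∷ (inj₂ (e , p) , inj₁ w) ∷ expand l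

  expand-isWalk : ∀ {x s} (l : Lift x s) → IsWalkFrom H x s → IsWalkFrom H′ (inj₁ x) (expand l)
  expand-isWalk [] _ = tt
  expand-isWalk (direct x≠u w≠u l) ((x≢w , ex , ew) , p) =
    ((λ eq → x≢w (inj₁-injective eq)) , (ex , x≠u) , (ew , w≠u)) , expand-isWalk l p
  expand-isWalk (fromU _ x≡u l) ((x≢w , _ , ew) , p) =
    ((λ ()) , x≡u , refl)
    , ((λ ()) , refl , (ew , λ _ w≡u → x≢w (trans x≡u (sym w≡u))))
    , expand-isWalk l p
  expand-isWalk (toU _ w≡u l) ((x≢w , ex , _) , p) =
    ((λ ()) , (ex , λ _ x≡u → x≢w (trans x≡u (sym w≡u))) , refl)
    , ((λ ()) , refl , w≡u)
    , expand-isWalk l p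

  expand-isWalk⁻ : ∀ {x s} (l : Lift x s) → IsWalkFrom H′ (inj₁ x) (expand l) → IsWalkFrom H x s
  expand-isWalk⁻ [] _ = tt
  expand-isWalk⁻ (direct _ _ l) ((x≢w , (ex , _) , (ew , _)) , p) =
    ((λ eq → x≢w (cong inj₁ eq)) , ex , ew) , expand-isWalk⁻ l p
  expand-isWalk⁻ (fromU {e = e} Fe x≡u l) (_ , (_ , _ , (ew , w≢u)) , p) =
    ((λ x≡w → w≢u Fe (trans (sym x≡w) x≡u)) , subst (inc H e) (sym x≡u) (F∋u e Fe) , ew)
    , expand-isWalk⁻ l p
  expand-isWalk⁻ (toU {e = e} Fe w≡u l) ((_ , (ex , x≢u) , _) , _ , p) =
    ((λ x≡w → x≢u Fe (trans x≡w w≡u)) , ex , subst (inc H e) (sym w≡u) (F∋u e Fe))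
    , expand-isWalk⁻ l p

  expand-lastAnchor : ∀ {x s} (l : Lift x s) →
    lastAnchor H′ (inj₁ x) (expand l) ≡ inj₁ (lastAnchor H x s)
  expand-lastAnchor [] = refl
  expand-lastAnchor (direct _ _ l) = expand-lastAnchor l
  expand-lastAnchor (fromU _ _ l) = expand-lastAnchor l
  expand-lastAnchor (toU _ _ l) = expand-lastAnchor l

  expand-length : ∀ {x s} (l : Lift x s) → length s ≤ length (expand l)
  expand-length [] = z≤n
  expand-length (direct _ _ l) = s≤s (expand-length l)
  expand-length (fromU _ _ l) = s≤s (m≤n⇒m≤1+n (expand-length l))
  expand-length (toU _ _ l) = s≤s (m≤n⇒m≤1+n (expand-length l))

  expand-nonempty : ∀ {x s} (l : Lift x s) → 0 < length (expand l) → 0 < length s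
  expand-nonempty (direct _ _ _) _ = s≤s z≤n
  expand-nonempty (fromU _ _ _) _ = s≤s z≤n
  expand-nonempty (toU _ _ _) _ = s≤s z≤n

  expand-edge⁺ : ∀ {x s} (l : Lift x s) {e} → e ∈ map proj₁ s → inj₁ e ∈ map proj₁ (expand l)
  expand-edge⁺ (direct _ _ _) (here refl) = here refl
  expand-edge⁺ (direct _ _ l) (there e∈) = there (expand-edge⁺ l e∈)
  expand-edge⁺ (fromU _ _ _) (here refl) = there (here refl)
  expand-edge⁺ (fromU _ _ l) (there e∈) = there (there (expand-edge⁺ l e∈))
  expand-edge⁺ (toU _ _ _) (here refl) = here refl
  expand-edge⁺ (toU _ _ l) (there e∈) = there (there (expand-edge⁺ l e∈))

  expand-parent : ∀ {x s} (l : Lift x s) {e′} → e′ ∈ map proj₁ (expand l) → parent e′ ∈ map proj₁ s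
  expand-parent (direct _ _ _) (here refl) = here refl
  expand-parent (direct _ _ l) (there e′∈) = there (expand-parent l e′∈)
  expand-parent (fromU _ _ _) (here refl) = here refl
  expand-parent (fromU _ _ _) (there (here refl)) = here refl
  expand-parent (fromU _ _ l) (there (there e′∈)) = there (expand-parent l e′∈)
  expand-parent (toU _ _ _) (here refl) = here refl
  expand-parent (toU _ _ _) (there (here refl)) = here refl
  expand-parent (toU _ _ l) (there (there e′∈)) = there (expand-parent l e′∈)

  expand-traverses⁺ : ∀ {x s} (l : Lift x s) {f} (q : F f ≡ true) →
    TravFrom H u f x s → inj₂ (f , q) ∈ map proj₁ (expand l)
  expand-traverses⁺ (direct x≢u _ _) q (inj₁ (refl , inj₁ x≡u)) = contradiction x≡u (x≢u q)
  expand-traverses⁺ (direct _ w≢u _) q (inj₁ (refl , inj₂ w≡u)) = contradiction w≡u (w≢u q)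
  expand-traverses⁺ (direct _ _ l) q (inj₂ t) = there (expand-traverses⁺ l q t)
  expand-traverses⁺ (fromU p _ _) q (inj₁ (refl , _)) = here (cong inj₂ (FE-≡ q p))
  expand-traverses⁺ (fromU _ _ l) q (inj₂ t) = there (there (expand-traverses⁺ l q t))
  expand-traverses⁺ (toU p _ _) q (inj₁ (refl , _)) = there (here (cong inj₂ (FE-≡ q p)))
  expand-traverses⁺ (toU _ _ l) q (inj₂ t) = there (there (expand-traverses⁺ l q t))

  expand-traverses⁻ : ∀ {x s} (l : Lift x s) {f q} →
    inj₂ (f , q) ∈ map proj₁ (expand l) → TravFrom H u f x s
  expand-traverses⁻ (direct _ _ l) (there f∈) = inj₂ (expand-traverses⁻ l f∈)
  expand-traverses⁻ (fromU _ x≡u _) (here refl) = inj₁ (refl , inj₁ x≡u)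
  expand-traverses⁻ (fromU _ _ l) (there (there f∈)) = inj₂ (expand-traverses⁻ l f∈)
  expand-traverses⁻ (toU _ w≡u _) (there (here refl)) = inj₁ (refl , inj₂ w≡u)
  expand-traverses⁻ (toU _ _ l) (there (there f∈)) = inj₂ (expand-traverses⁻ l f∈)

  expand-anchor⁺ : ∀ {x s} (l : Lift x s) {a} →
    a ∈ anchors H (walk x s) → inj₁ a ∈ anchors H′ (walk (inj₁ x) (expand l))
  expand-anchor⁺ _ (here refl) = here refl
  expand-anchor⁺ (direct _ _ l) (there a∈) = there (expand-anchor⁺ l a∈)
  expand-anchor⁺ (fromU _ _ l) (there a∈) = there (there (expand-anchor⁺ l a∈))
  expand-anchor⁺ (toU _ _ l) (there a∈) = there (there (expand-anchor⁺ l a∈))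

  expand-anchor⁻ : ∀ {x s} (l : Lift x s) {a} →
    inj₁ a ∈ anchors H′ (walk (inj₁ x) (expand l)) → a ∈ anchors H (walk x s)
  expand-anchor⁻ _ (here refl) = here refl
  expand-anchor⁻ (direct _ _ l) (there a∈) = there (expand-anchor⁻ l a∈)
  expand-anchor⁻ (fromU _ _ l) (there (there a∈)) = there (expand-anchor⁻ l a∈)
  expand-anchor⁻ (toU _ _ l) (there (there a∈)) = there (expand-anchor⁻ l a∈)

  expand-newAnchor⁻ : ∀ {x s} (l : Lift x s) {g} →
    inj₂ g ∈ anchors H′ (walk (inj₁ x) (expand l)) → proj₁ g ∈ edges H (walk x s)
  expand-newAnchor⁻ (direct _ _ l) (there g∈) = there (expand-newAnchor⁻ l g∈)
  expand-newAnchor⁻ (fromU _ _ _) (there (here refl)) = here refl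
  expand-newAnchor⁻ (fromU _ _ l) (there (there g∈)) = there (expand-newAnchor⁻ l g∈)
  expand-newAnchor⁻ (toU _ _ _) (there (here refl)) = here refl
  expand-newAnchor⁻ (toU _ _ l) (there (there g∈)) = there (expand-newAnchor⁻ l g∈)

  expand-fresh : ∀ {x s} (l : Lift x s) {e′} →
    All (parent e′ ≢_) (map proj₁ s) → All (e′ ≢_) (map proj₁ (expand l))
  expand-fresh l e′∉ = ¬Any⇒All¬ _ (λ e′∈ → All¬⇒¬Any e′∉ (expand-parent l e′∈))

  expand-fresh⁻ : ∀ {x s} (l : Lift x s) {e} →
    All (inj₁ e ≢_) (map proj₁ (expand l)) → All (e ≢_) (map proj₁ s)
  expand-fresh⁻ l e∉ = ¬Any⇒All¬ _ (λ e∈ → All¬⇒¬Any e∉ (expand-edge⁺ l e∈))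

  expand-unique : ∀ {x s} (l : Lift x s) → Unique (map proj₁ s) → Unique (map proj₁ (expand l))
  expand-unique [] [] = []
  expand-unique (direct _ _ l) (e∉ ∷ un) = expand-fresh l e∉ ∷ expand-unique l un
  expand-unique (fromU _ _ l) (e∉ ∷ un) =
    ((λ ()) ∷ expand-fresh l e∉) ∷ expand-fresh l e∉ ∷ expand-unique l un
  expand-unique (toU _ _ l) (e∉ ∷ un) =
    ((λ ()) ∷ expand-fresh l e∉) ∷ expand-fresh l e∉ ∷ expand-unique l un

  expand-unique⁻ : ∀ {x s} (l : Lift x s) → Unique (map proj₁ (expand l)) → Unique (map proj₁ s)
  expand-unique⁻ [] _ = []
  expand-unique⁻ (direct _ _ l) (e∉ ∷ un) = expand-fresh⁻ l e∉ ∷ expand-unique⁻ l un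
  expand-unique⁻ (fromU _ _ l) (_ ∷ e∉ ∷ un) = expand-fresh⁻ l e∉ ∷ expand-unique⁻ l un
  expand-unique⁻ (toU _ _ l) ((_ ∷ e∉) ∷ _ ∷ un) = expand-fresh⁻ l e∉ ∷ expand-unique⁻ l un

  expand-isClosedTrail : ∀ {x s} (l : Lift x s) →
    IsClosedTrail H (walk x s) → IsClosedTrail H′ (walk (inj₁ x) (expand l))
  expand-isClosedTrail l (p , (closed , len) , un) =
    expand-isWalk l p
    , (trans (expand-lastAnchor l) (cong inj₁ closed) , ≤-trans len (expand-length l))
    , expand-unique l un

  expand-isClosedTrail⁻ : ∀ {x s} (l : Lift x s) →
    IsClosedTrail H′ (walk (inj₁ x) (expand l)) → IsClosedTrail H (walk x s)
  expand-isClosedTrail⁻ {x} {s} l (p′ , (closed′ , len′) , un′) =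
    p , (closed , closedWalk-length H x s p closed (expand-nonempty l (≤-trans (s≤s z≤n) len′)))
    , expand-unique⁻ l un′
    where
    p = expand-isWalk⁻ l p′
    closed = inj₁-injective (trans (sym (expand-lastAnchor l)) closed′)

  TraversesUViaF : Walk H → Set
  TraversesUViaF W = ∀ f → F f ≡ true → f ∈ edges H W → Traverses H W u f

  traversesUViaF-tail : ∀ {x e w s} → All (e ≢_) (map proj₁ s) →
    TraversesUViaF (walk x ((e , w) ∷ s)) → TraversesUViaF (walk w s)
  traversesUViaF-tail e∉ via f q f∈ with via f q (there f∈)
  ... | inj₁ (refl , _) = contradiction f∈ (All¬⇒¬Any e∉)
  ... | inj₂ t = t

  lift-step : ∀ {x e w s} → e ∉ map proj₁ s → (F e ≡ true → TravFrom H u e x ((e , w) ∷ s)) →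
    Lift w s → Lift x ((e , w) ∷ s)
  lift-step {e = e} {w} {s} e∉ trav l with F e in Fe
  ... | false = direct (λ T → contradiction (trans (sym T) Fe) λ ())
                       (λ T → contradiction (trans (sym T) Fe) λ ()) l
  ... | true with trav refl
  ...   | inj₁ (_ , inj₁ x≡u) = fromU Fe x≡u l
  ...   | inj₁ (_ , inj₂ w≡u) = toU Fe w≡u l
  ...   | inj₂ t = contradiction (travFrom⇒∈ H w s t) e∉

  lift : ∀ x s → Unique (map proj₁ s) → TraversesUViaF (walk x s) → Lift x s
  lift x [] _ _ = []
  lift x ((e , w) ∷ s) (e∉ ∷ un) via =
    lift-step (All¬⇒¬Any e∉) (λ q → via e q (here refl))
      (lift w s un (traversesUViaF-tail e∉ via))

  -- Adjacency in H′ and distinctness of edges leave only two ways to enter and leave a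
  -- new vertex u_f: x f′ u_f e_f u and u e_f u_f f′ y.
  trail-is-expansion : ∀ {z} x (s′ : Steps H′) → IsWalkFrom H′ (inj₁ x) s′ →
    Unique (map proj₁ s′) → lastAnchor H′ (inj₁ x) s′ ≡ inj₁ z →
    ∃₂ λ s (l : Lift x s) → expand l ≡ s′
  trail-is-expansion x [] _ _ _ = [] , [] , refl
  trail-is-expansion x ((inj₁ e , inj₁ w) ∷ s′) ((_ , (_ , x≢u) , (_ , w≢u)) , p) (_ ∷ un) end
    with s , l , refl ← trail-is-expansion w s′ p un end = _ , direct x≢u w≢u l , refl
  trail-is-expansion x ((inj₂ _ , inj₁ w) ∷ _) ((x≢w , x≡u , w≡u) , _) _ _ =
    contradiction (cong inj₁ (trans x≡u (sym w≡u))) x≢w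
  trail-is-expansion x ((_ , inj₂ _) ∷ (_ , inj₂ _) ∷ _) (_ , a , _) _ _ =
    ⊥-elim (new-nonadjacent a)
  trail-is-expansion x ((inj₁ _ , inj₂ _) ∷ (inj₁ _ , inj₁ _) ∷ _)
    ((_ , _ , refl) , (_ , refl , _) , _) ((f′≢f′ ∷ _) ∷ _) _ = contradiction refl f′≢f′
  trail-is-expansion x ((inj₂ (_ , p) , inj₂ _) ∷ (inj₂ (_ , q) , inj₁ _) ∷ _)
    ((_ , _ , refl) , (_ , refl , _) , _) ((e≢e ∷ _) ∷ _) _ =
    contradiction (cong inj₂ (FE-≡ p q)) e≢e
  trail-is-expansion x ((inj₁ _ , inj₂ (_ , q)) ∷ (inj₂ (_ , q′) , inj₁ y) ∷ s′)
    ((_ , _ , refl) , (_ , refl , y≡u) , p) (_ ∷ _ ∷ un) end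
    with s , l , refl ← trail-is-expansion y s′ p un end | refl ← FE-≡ q q′ =
    _ , toU q y≡u l , refl
  trail-is-expansion x ((inj₂ (_ , q′) , inj₂ (_ , q)) ∷ (inj₁ _ , inj₁ y) ∷ s′)
    ((_ , x≡u , refl) , (_ , refl , _) , p) (_ ∷ _ ∷ un) end
    with s , l , refl ← trail-is-expansion y s′ p un end | refl ← FE-≡ q q′ =
    _ , fromU q x≡u l , refl

  record Corresponds (W : Walk H) (W′ : Walk H′) : Set where
    field
      trail : IsClosedTrail H W
      trail′ : IsClosedTrail H′ W′
      edge⁺ : ∀ {e} → e ∈ edges H W → inj₁ e ∈ edges H′ W′
      parent⁻ : ∀ {e′} → e′ ∈ edges H′ W′ → parent e′ ∈ edges H W
      traverses⁺ : ∀ {f} (q : F f ≡ true) → Traverses H W u f → inj₂ (f , q) ∈ edges H′ W′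
      traverses⁻ : ∀ {f q} → inj₂ (f , q) ∈ edges H′ W′ → Traverses H W u f
      anchor⁺ : ∀ {a} → a ∈ anchors H W → inj₁ a ∈ anchors H′ W′
      anchor⁻ : ∀ {a} → inj₁ a ∈ anchors H′ W′ → a ∈ anchors H W
      newAnchor⁻ : ∀ {g} → inj₂ g ∈ anchors H′ W′ → proj₁ g ∈ edges H W
  open Corresponds

  expand-corresponds : ∀ {x s} (l : Lift x s) → IsClosedTrail H (walk x s) →
    IsClosedTrail H′ (walk (inj₁ x) (expand l)) → Corresponds (walk x s) (walk (inj₁ x) (expand l))
  expand-corresponds l t t′ = record
    { trail = t
    ; trail′ = t′
    ; edge⁺ = expand-edge⁺ l
    ; parent⁻ = expand-parent l
    ; traverses⁺ = expand-traverses⁺ l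
    ; traverses⁻ = expand-traverses⁻ l
    ; anchor⁺ = expand-anchor⁺ l
    ; anchor⁻ = expand-anchor⁻ l
    ; newAnchor⁻ = expand-newAnchor⁻ l
    }

  corresponds-resp-sameSupport : ∀ {W R′ W′} → SameSupport H′ R′ W′ → IsClosedTrail H′ W′ →
    Corresponds W R′ → Corresponds W W′
  corresponds-resp-sameSupport same t′ c = record
    { trail = trail c
    ; trail′ = t′
    ; edge⁺ = λ e∈ → edges⊆ (edge⁺ c e∈)
    ; parent⁻ = λ e′∈ → parent⁻ c (edges⊇ e′∈)
    ; traverses⁺ = λ q t → edges⊆ (traverses⁺ c q t)
    ; traverses⁻ = λ f∈ → traverses⁻ c (edges⊇ f∈)
    ; anchor⁺ = λ a∈ → anchors⊆ (anchor⁺ c a∈)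
    ; anchor⁻ = λ a∈ → anchor⁻ c (anchors⊇ a∈)
    ; newAnchor⁻ = λ g∈ → newAnchor⁻ c (anchors⊇ g∈)
    }
    where open SameSupport same

  corresponds-disjoint : ∀ {W₁ W₁′ W₂ W₂′} → Corresponds W₁ W₁′ → Corresponds W₂ W₂′ →
    EdgeAnchorDisjoint H W₁ W₂ → EdgeAnchorDisjoint H′ W₁′ W₂′
  corresponds-disjoint {W₁′ = W₁′} {W₂′ = W₂′} c₁ c₂ (ed , ad) =
    (λ e∈₁ e∈₂ → ed (parent⁻ c₁ e∈₁) (parent⁻ c₂ e∈₂)) , ad′
    where
    ad′ : Disjoint H′ (anchors H′ W₁′) (anchors H′ W₂′)
    ad′ {inj₁ _} a∈₁ a∈₂ = ad (anchor⁻ c₁ a∈₁) (anchor⁻ c₂ a∈₂)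
    ad′ {inj₂ _} g∈₁ g∈₂ = ed (newAnchor⁻ c₁ g∈₁) (newAnchor⁻ c₂ g∈₂)

  corresponds-disjoint⁻ : ∀ {W₁ W₁′ W₂ W₂′} → Corresponds W₁ W₁′ → Corresponds W₂ W₂′ →
    EdgeAnchorDisjoint H′ W₁′ W₂′ → EdgeAnchorDisjoint H W₁ W₂
  corresponds-disjoint⁻ c₁ c₂ (ed , ad) =
    (λ e∈₁ e∈₂ → ed (edge⁺ c₁ e∈₁) (edge⁺ c₂ e∈₂))
    , (λ a∈₁ a∈₂ → ad (anchor⁺ c₁ a∈₁) (anchor⁺ c₂ a∈₂))

  Expansion : Walk H → Walk H′ → Set
  Expansion W W′ = Corresponds W W′ × TraversesUViaF W

  expansion : ∀ W → IsClosedTrail H W → TraversesUViaF W → ∃ (Expansion W)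
  expansion (walk x s) t via =
    walk (inj₁ x) (expand l) , expand-corresponds l t (expand-isClosedTrail l t) , via
    where l = lift x s (proj₂ (proj₂ t)) via

  contraction-fromOld : ∀ x s′ → IsClosedTrail H′ (walk (inj₁ x) s′) →
    ∃ λ W → Corresponds W (walk (inj₁ x) s′)
  contraction-fromOld x s′ t′@(p , (closed , _) , un)
    with s , l , refl ← trail-is-expansion x s′ p un closed =
    walk x s , expand-corresponds l (expand-isClosedTrail⁻ l t′) t′

  contraction : ∀ W′ → IsClosedTrail H′ W′ → ∃ λ W → Corresponds W W′
  contraction (walk (inj₁ x) s′) t′ = contraction-fromOld x s′ t′
  contraction (walk (inj₂ _) ((_ , inj₂ _) ∷ _)) ((a , _) , _) = ⊥-elim (new-nonadjacent a)
  contraction (walk (inj₂ _) ((e′ , inj₁ x) ∷ s′)) t′@(_ , (closed , _) , _)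
    with W , c ← contraction-fromOld x (s′ ∷ʳ (e′ , inj₁ x)) (rotate-isClosedTrail H′ s′ t′) =
    W , corresponds-resp-sameSupport (rotate-sameSupport H′ s′ closed) t′ c

  expansion-cover : ∀ e′ → ∃ λ e → ∀ {W W′} → Expansion W W′ → e ∈ edges H W → e′ ∈ edges H′ W′
  expansion-cover (inj₁ e) = e , λ (c , _) → edge⁺ c
  expansion-cover (inj₂ (f , q)) = f , λ (c , via) f∈ → traverses⁺ c q (via f q f∈)

  expansion-disjoint : ∀ {W₁ W₁′ W₂ W₂′} → Expansion W₁ W₁′ → Expansion W₂ W₂′ →
    EdgeAnchorDisjoint H W₁ W₂ → EdgeAnchorDisjoint H′ W₁′ W₂′
  expansion-disjoint (c₁ , _) (c₂ , _) = corresponds-disjoint c₁ c₂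

  expansion-trail : ∀ {W W′} → Expansion W W′ → IsClosedTrail H′ W′
  expansion-trail (c , _) = trail′ c

  contraction-cover : ∀ e → ∃ λ e′ → ∀ {W′ W} → Corresponds W W′ → e′ ∈ edges H′ W′ → e ∈ edges H W
  contraction-cover e = inj₁ e , λ c → parent⁻ c

  module Forward = Transfer Expansion expansion-trail expansion-disjoint expansion-cover
  module Backward = Transfer (flip Corresponds) trail corresponds-disjoint⁻ contraction-cover

  family-traversesUViaF : ∀ {Ws} → AllPairs (EdgeAnchorDisjoint H) Ws →
    (∀ f → F f ≡ true → ∃ λ W → W ∈ Ws × Traverses H W u f) → ∀ {W} → W ∈ Ws → TraversesUViaF W
  family-traversesUViaF disjoint via W∈ f q f∈ with via f q
  ... | W₀ , W₀∈ , t with AllPairs-∈ disjoint W₀∈ W∈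
  ...   | inj₁ refl = t
  ...   | inj₂ (inj₁ (ed , _)) = contradiction f∈ (ed (traverses⇒∈edges H W₀ t))
  ...   | inj₂ (inj₂ (ed , _)) = contradiction (traverses⇒∈edges H W₀ t) (ed f∈)

  family→ : HasEulerFamilyVia H u F → HasEulerFamily H′
  family→ (Ws , family@(trails , disjoint , _) , via)
    with Ws′ , rs ← All∃⇒Pointwise (All.tabulate λ {W} W∈ →
           expansion W (All.lookup trails W∈) (family-traversesUViaF disjoint via W∈)) =
    Ws′ , Forward.eulerFamily rs family

  family← : HasEulerFamily H′ → HasEulerFamilyVia H u F
  family← (Ws′ , family′@(trails′ , _ , covered′))
    with Ws , rs ← All∃⇒Pointwise (All.map (λ {W′} → contraction W′) trails′) =
    Ws , Backward.eulerFamily rs family′ , via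
    where
    via : ∀ f → F f ≡ true → ∃ λ W → W ∈ Ws × Traverses H W u f
    via f q with covered′ (inj₂ (f , q))
    ... | W′ , W′∈ , f∈ with Pointwise-∈ˡ rs W′∈
    ...   | W , W∈ , c = W , W∈ , traverses⁻ c f∈

  tour→ : HasEulerTourVia H u F → HasEulerTour H′
  tour→ (W , tour@(t , _) , via) with W′ , e ← expansion W t (λ f q _ → via f q) =
    W′ , Forward.eulerTour e tour

  tour← : HasEulerTour H′ → HasEulerTourVia H u F
  tour← (W′ , tour′@(t′ , covered′)) with W , c ← contraction W′ t′ =
    W , Backward.eulerTour c tour′ , λ f q → traverses⁻ c (covered′ (inj₂ (f , q)))

lemma6p5 : (H : Hypergraph) → IsFinite H → (u : Vtx H) (F : Edg H → Bool)
    → (∀ f → F f ≡ true → inc H f u)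
    → (HasEulerFamilyVia H u F ⇔ HasEulerFamily (split H u F))
    × (HasEulerTourVia H u F ⇔ HasEulerTour (split H u F))
lemma6p5 H _ u F F∋u = mk⇔ family→ family← , mk⇔ tour→ tour←
  where open Splitting H u F F∋u
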